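{- For the elementary cellular automaton $F_{132}$, $D(\textsc{Pred}_{F_{132},n})\in O(\log n)$.
   Context: The ECA with Wolfram number $N$ is $F_N:\{0,1\}^{\mathbb{Z}}\to\{0,1\}^{\mathbb{Z}}$, $(F_N(x))_i=f_N(x_{i-1},x_i,x_{i+1})$, where $f_N(a,b,c)$ is the bit of index $4a+2b+c$ of $N$ in binary. On a finite word of length $m$, $F_N$ returns the word of length $m-2$ obtained by applying $f_N$ wherever it is defined. $\textsc{Pred}_{F,n}:\{0,1\}^{2n+1}\to\{0,1\}$ maps $x$ to the unique cell of $F^n(x)$. For finite sets $X,Y,Z$ and $g:X\times Y\to Z$, $D(g)$ is the minimal depth of a deterministic two-party communication protocol tree computing $g$ (Alice knows $x$, Bob knows $y$; internal nodes are labelled by a function of $x$ alone or of $y$ alone to $\{\mathrm{l},\mathrm{r}\}$ selecting the child, leaves are labelled by outputs). For $g:\{0,1\}^m\to Z$, $D(g)=\max_{0\le i\le m} D(g_i)$ where $g_i:\{0,1\}^i\times\{0,1\}^{m-i}\to Z$, $g_i(x,y)=g(xy)$. -}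

module Defs where

open import Data.Nat using (ℕ; zero; suc; _+_; _*_; _^_; _≡ᵇ_; _≤_)
open import Data.Nat.DivMod using (_/_; _%_)
open import Data.Bool using (Bool; true; false; if_then_else_)
open import Data.Vec using (Vec; []; _∷_; _++_; head)
open import Relation.Binary.PropositionalEquality using (_≡_; subst)
open import Data.Product using (∃; _×_)

bit : Bool → ℕ
bit false = 0
bit true  = 1

testBit : ℕ → ℕ → Bool
testBit N zero    = (N % 2) ≡ᵇ 1
testBit N (suc k) = testBit (N / 2) k

rule : ℕ → Bool → Bool → Bool → Bool
rule N a b c = testBit N (4 * bit a + 2 * bit b + bit c)

step : (N : ℕ) {m : ℕ} → Vec Bool (suc (suc m)) → Vec Bool m
step N {zero}  _                   = []
step N {suc m} (a ∷ b ∷ c ∷ rest) = rule N a b c ∷ step N {m} (b ∷ c ∷ rest)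

-- odd n = 2n+1, defined so that odd (suc n) reduces to suc (suc (odd n))
odd : ℕ → ℕ
odd zero    = 1
odd (suc n) = suc (suc (odd n))

iter : (N n : ℕ) → Vec Bool (odd n) → Vec Bool 1
iter N zero    x = x
iter N (suc n) x = iter N n (step N x)

Pred : (N n : ℕ) → Vec Bool (odd n) → Bool
Pred N n x = head (iter N n x)

data Protocol (X Y Z : Set) : Set where
  leaf  : Z → Protocol X Y Z
  alice : (X → Bool) → Protocol X Y Z → Protocol X Y Z → Protocol X Y Z
  bob   : (Y → Bool) → Protocol X Y Z → Protocol X Y Z → Protocol X Y Z

run : {X Y Z : Set} → Protocol X Y Z → X → Y → Z
run (leaf z)      x y = z
run (alice f l r) x y = if f x then run r x y else run l x y
run (bob f l r)   x y = if f y then run r x y else run l x y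

depth : {X Y Z : Set} → Protocol X Y Z → ℕ
depth (leaf _)      = 0
depth (alice _ l r) = suc (depth l Data.Nat.⊔ depth r)
depth (bob _ l r)   = suc (depth l Data.Nat.⊔ depth r)

-- D(g) ≤ k for g : X × Y → Z  (D is a minimum, so this says some
-- protocol of depth ≤ k computes g)
D≤ : {X Y Z : Set} → (X → Y → Z) → ℕ → Set
D≤ {X} {Y} {Z} g k =
  ∃ λ (P : Protocol X Y Z) → (depth P ≤ k) × (∀ x y → run P x y ≡ g x y)

-- D(g) ≤ k for g : {0,1}^m → Z, D(g) = max over all cuts i + j = m of D(g_i)
Dfun≤ : {Z : Set} {m : ℕ} → (Vec Bool m → Z) → ℕ → Set
Dfun≤ {Z} {m} g k =
  (i j : ℕ) (e : i + j ≡ m) →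
  D≤ (λ (x : Vec Bool i) (y : Vec Bool j) → g (subst (Vec Bool) e (x ++ y))) k

-- F₁₃₂ keeps a cell alive exactly when it is 1 and its two neighbours agree, so every
-- block of ones loses one cell at each end per step. Hence Pred(x) = 1 iff the centre
-- cell is 1 and the runs of ones directly to its left and to its right are equally long.
-- For any cut, one party's whole input lies on one side of the centre, so that party
-- only has to announce the length of the run of ones touching the cut: a number ≤ n,
-- sent in ⌊log₂ n⌋ + 1 bits by binary search, after which the other party knows the answer.
module Submission where

open import Data.Bool using (Bool; true; false; _∧_)
open import Data.Bool.Properties using (∧-identityʳ)
open import Data.List using (List; []; _∷_; _++_; foldl; foldr; length; replicate; reverse)
open import Data.List.Properties
  using (++-assoc; length-reverse; reverse-++; reverse-foldl; reverse-involutive; unfold-reverse)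
open import Data.Nat using (ℕ; zero; suc; _+_; _*_; _∸_; _^_; _≡ᵇ_; _≤ᵇ_; _≤_; _<_; _≤?_; _⊔_; z≤n; s≤s)
open import Data.Nat.Logarithm using (⌊log₂_⌋; ⌊log₂⌋-mono-≤; ⌊log₂[2^n]⌋≡n)
open import Data.Nat.Properties
open import Data.Product using (∃₂; ∃-syntax; _×_; _,_)
open import Data.Vec using (Vec; toList)
import Data.Vec as Vec
open import Data.Vec.Properties using (toList-++; length-toList)
open import Function using (flip; _∘_)
open import Relation.Nullary using (yes; no)
open import Relation.Nullary.Reflects using (ofʸ; ofⁿ)
open import Relation.Nullary.Negation using (contradiction)
open import Relation.Binary.PropositionalEquality

open import Defs

rule132 : Bool → Bool → Bool → Bool
rule132 = rule 132

rule132-sym : ∀ a b c → rule132 a b c ≡ rule132 c b a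
rule132-sym false false false = refl
rule132-sym false false true  = refl
rule132-sym false true  false = refl
rule132-sym false true  true  = refl
rule132-sym true  false false = refl
rule132-sym true  false true  = refl
rule132-sym true  true  false = refl
rule132-sym true  true  true  = refl

rule132-false : ∀ a c → rule132 a false c ≡ false
rule132-false false false = refl
rule132-false false true  = refl
rule132-false true  false = refl
rule132-false true  true  = refl

step132 : List Bool → List Bool
step132 (a ∷ b ∷ c ∷ l) = rule132 a b c ∷ step132 (b ∷ c ∷ l)
step132 _               = []

toList-step : ∀ {m} (w : Vec Bool (suc (suc m))) → toList (step 132 w) ≡ step132 (toList w)
toList-step {zero}  (a Vec.∷ b Vec.∷ Vec.[])    = refl
toList-step {suc m} (a Vec.∷ b Vec.∷ c Vec.∷ w) = cong (rule132 a b c ∷_) (toList-step (b Vec.∷ c Vec.∷ w))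

length-step132 : ∀ a b l → length (step132 (a ∷ b ∷ l)) ≡ length l
length-step132 a b []      = refl
length-step132 a b (c ∷ l) = cong suc (length-step132 b c l)

step132-++ : ∀ u a b v → step132 (u ++ a ∷ b ∷ v) ≡ step132 (u ++ a ∷ b ∷ []) ++ step132 (a ∷ b ∷ v)
step132-++ []              a b v = refl
step132-++ (x ∷ [])        a b v = refl
step132-++ (x ∷ y ∷ [])    a b v = cong (rule132 x y a ∷_) (step132-++ (y ∷ []) a b v)
step132-++ (x ∷ y ∷ z ∷ u) a b v = cong (rule132 x y z ∷_) (step132-++ (y ∷ z ∷ u) a b v)

step132-reverse : ∀ l → step132 (reverse l) ≡ reverse (step132 l)
step132-reverse []           = refl
step132-reverse (x ∷ [])     = refl
step132-reverse (x ∷ y ∷ []) = refl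
step132-reverse (x ∷ y ∷ z ∷ l) = begin
  step132 (reverse (x ∷ y ∷ z ∷ l))                    ≡⟨ cong step132 (reverse-++ (x ∷ y ∷ z ∷ []) l) ⟩
  step132 (reverse l ++ z ∷ y ∷ x ∷ [])                ≡⟨ step132-++ (reverse l) z y (x ∷ []) ⟩
  step132 (reverse l ++ z ∷ y ∷ []) ++ rule132 z y x ∷ []
    ≡⟨ cong₂ (λ u c → step132 u ++ c ∷ []) (sym (reverse-++ (y ∷ z ∷ []) l)) (rule132-sym z y x) ⟩
  step132 (reverse (y ∷ z ∷ l)) ++ rule132 x y z ∷ []  ≡⟨ cong (_++ rule132 x y z ∷ []) (step132-reverse (y ∷ z ∷ l)) ⟩
  reverse (step132 (y ∷ z ∷ l)) ++ rule132 x y z ∷ []  ≡⟨ sym (unfold-reverse (rule132 x y z) (step132 (y ∷ z ∷ l))) ⟩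
  reverse (step132 (x ∷ y ∷ z ∷ l))                    ∎
  where open ≡-Reasoning

step132-around : ∀ l lr c r R →
  step132 (reverse (l ∷ lr) ++ c ∷ r ∷ R) ≡
  reverse (step132 (c ∷ l ∷ lr)) ++ rule132 l c r ∷ step132 (c ∷ r ∷ R)
step132-around l lr c r R = begin
  step132 (reverse (l ∷ lr) ++ c ∷ r ∷ R)                 ≡⟨ cong (λ u → step132 (u ++ c ∷ r ∷ R)) (unfold-reverse l lr) ⟩
  step132 ((reverse lr ++ l ∷ []) ++ c ∷ r ∷ R)           ≡⟨ cong step132 (++-assoc (reverse lr) (l ∷ []) (c ∷ r ∷ R)) ⟩
  step132 (reverse lr ++ l ∷ c ∷ r ∷ R)                   ≡⟨ step132-++ (reverse lr) l c (r ∷ R) ⟩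
  step132 (reverse lr ++ l ∷ c ∷ []) ++ right             ≡⟨ cong (λ u → step132 u ++ right) (sym (reverse-++ (c ∷ l ∷ []) lr)) ⟩
  step132 (reverse (c ∷ l ∷ lr)) ++ right                 ≡⟨ cong (_++ right) (step132-reverse (c ∷ l ∷ lr)) ⟩
  reverse (step132 (c ∷ l ∷ lr)) ++ right                 ∎
  where
  open ≡-Reasoning
  right : List Bool
  right = rule132 l c r ∷ step132 (c ∷ r ∷ R)

extendRun : ℕ → Bool → ℕ
extendRun r true  = suc r
extendRun r false = 0

leadingOnes : List Bool → ℕ
leadingOnes = foldr (flip extendRun) 0

trailingOnes : List Bool → ℕ
trailingOnes = foldl extendRun 0

trailingOnes≡leadingOnes-reverse : ∀ l → trailingOnes l ≡ leadingOnes (reverse l)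
trailingOnes≡leadingOnes-reverse l = begin
  trailingOnes l                     ≡⟨ cong trailingOnes (sym (reverse-involutive l)) ⟩
  trailingOnes (reverse (reverse l)) ≡⟨ reverse-foldl extendRun 0 (reverse l) ⟩
  leadingOnes (reverse l)            ∎
  where open ≡-Reasoning

leadingOnes≤length : ∀ l → leadingOnes l ≤ length l
leadingOnes≤length []          = z≤n
leadingOnes≤length (true ∷ l)  = s≤s (leadingOnes≤length l)
leadingOnes≤length (false ∷ l) = z≤n

trailingOnes≤length : ∀ l → trailingOnes l ≤ length l
trailingOnes≤length l = begin
  trailingOnes l          ≡⟨ trailingOnes≡leadingOnes-reverse l ⟩
  leadingOnes (reverse l) ≤⟨ leadingOnes≤length (reverse l) ⟩
  length (reverse l)      ≡⟨ length-reverse l ⟩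
  length l                ∎
  where open ≤-Reasoning

leadingOnes-replicate : ∀ m → leadingOnes (replicate m true) ≡ m
leadingOnes-replicate zero    = refl
leadingOnes-replicate (suc m) = cong suc (leadingOnes-replicate m)

leadingOnes-++-cong : ∀ u {v v′} → leadingOnes v ≡ leadingOnes v′ → leadingOnes (u ++ v) ≡ leadingOnes (u ++ v′)
leadingOnes-++-cong []      eq = eq
leadingOnes-++-cong (a ∷ u) eq = cong (flip extendRun a) (leadingOnes-++-cong u eq)

leadingOnes-step132 : ∀ R → leadingOnes (step132 (true ∷ R)) ≡ leadingOnes R ∸ 1
leadingOnes-step132 []                  = refl
leadingOnes-step132 (false ∷ [])        = refl
leadingOnes-step132 (false ∷ false ∷ _) = refl
leadingOnes-step132 (false ∷ true ∷ _)  = refl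
leadingOnes-step132 (true ∷ [])         = refl
leadingOnes-step132 (true ∷ false ∷ _)  = refl
leadingOnes-step132 (true ∷ true ∷ R)   = cong suc (leadingOnes-step132 (true ∷ R))

-- lr is the left half read outwards from the centre cell c.
centreValue : List Bool → Bool → List Bool → Bool
centreValue lr c R = c ∧ (leadingOnes lr ≡ᵇ leadingOnes R)

centreValue-step : ∀ l lr c r R →
  centreValue (step132 (c ∷ l ∷ lr)) (rule132 l c r) (step132 (c ∷ r ∷ R)) ≡ centreValue (l ∷ lr) c (r ∷ R)
centreValue-step l lr false r R rewrite rule132-false l r = refl
centreValue-step l lr true  r R rewrite leadingOnes-step132 (l ∷ lr) | leadingOnes-step132 (r ∷ R) =
  shrink l r
  where
  shrink : ∀ a b → rule132 a true b ∧ (leadingOnes (a ∷ lr) ∸ 1 ≡ᵇ leadingOnes (b ∷ R) ∸ 1)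
                 ≡ (leadingOnes (a ∷ lr) ≡ᵇ leadingOnes (b ∷ R))
  shrink false false = refl
  shrink false true  = refl
  shrink true  false = refl
  shrink true  true  = refl

Pred132-centre : ∀ n (w : Vec Bool (odd n)) lr c R → length lr ≡ n → length R ≡ n →
  toList w ≡ reverse lr ++ c ∷ R → Pred 132 n w ≡ centreValue lr c R
Pred132-centre zero    (a Vec.∷ Vec.[]) []        c []      refl refl refl = sym (∧-identityʳ a)
Pred132-centre (suc n) w               (l ∷ lr) c (r ∷ R) |lr| |R| w≡ = begin
  Pred 132 n (step 132 w)
    ≡⟨ Pred132-centre n (step 132 w) (step132 (c ∷ l ∷ lr)) (rule132 l c r) (step132 (c ∷ r ∷ R))
         (trans (length-step132 c l lr) (suc-injective |lr|))
         (trans (length-step132 c r R) (suc-injective |R|))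
         (trans (toList-step w) (trans (cong step132 w≡) (step132-around l lr c r R))) ⟩
  centreValue (step132 (c ∷ l ∷ lr)) (rule132 l c r) (step132 (c ∷ r ∷ R))
    ≡⟨ centreValue-step l lr c r R ⟩
  centreValue (l ∷ lr) c (r ∷ R) ∎
  where open ≡-Reasoning

-- The centre criterion for the cell at position k of l, when l is preceded by a run of r ones;
-- it reads l from the left, so a left prefix only enters through its trailing run.
predictAt : ℕ → ℕ → List Bool → Bool
predictAt zero    r []      = false
predictAt zero    r (c ∷ R) = c ∧ (r ≡ᵇ leadingOnes R)
predictAt (suc k) r []      = false
predictAt (suc k) r (a ∷ l) = predictAt k (extendRun r a) l

predictAt-++ˡ : ∀ k r xs ys → length xs ≤ k →
  predictAt k r (xs ++ ys) ≡ predictAt (k ∸ length xs) (foldl extendRun r xs) ys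
predictAt-++ˡ k       r []       ys _         = refl
predictAt-++ˡ (suc k) r (a ∷ xs) ys (s≤s |xs|) = predictAt-++ˡ k (extendRun r a) xs ys |xs|

predictAt-++ʳ : ∀ k r xs {ys ys′} → k < length xs → leadingOnes ys ≡ leadingOnes ys′ →
  predictAt k r (xs ++ ys) ≡ predictAt k r (xs ++ ys′)
predictAt-++ʳ zero    r (c ∷ R)  _          eq = cong (λ m → c ∧ (r ≡ᵇ m)) (leadingOnes-++-cong R eq)
predictAt-++ʳ (suc k) r (a ∷ xs) (s≤s k<xs) eq = predictAt-++ʳ k (extendRun r a) xs k<xs eq

splitAround : ∀ {A : Set} k m (l : List A) → length l ≡ k + suc m →
  ∃[ L ] ∃[ c ] ∃[ R ] length L ≡ k × length R ≡ m × l ≡ L ++ c ∷ R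
splitAround zero    m []      ()
splitAround (suc k) m []      ()
splitAround zero    m (c ∷ R) |l| = [] , c , R , refl , suc-injective |l| , refl
splitAround (suc k) m (a ∷ l) |l| with splitAround k m l (suc-injective |l|)
... | L , c , R , |L| , |R| , l≡ = a ∷ L , c , R , cong suc |L| , |R| , cong (a ∷_) l≡

odd≡n+suc[n] : ∀ n → odd n ≡ n + suc n
odd≡n+suc[n] zero    = refl
odd≡n+suc[n] (suc n) = cong suc (trans (cong suc (odd≡n+suc[n] n)) (sym (+-suc n (suc n))))

Pred132≡predictAt : ∀ n (w : Vec Bool (odd n)) → Pred 132 n w ≡ predictAt n 0 (toList w)
Pred132≡predictAt n w with splitAround n n (toList w) (trans (length-toList w) (odd≡n+suc[n] n))
... | L , c , R , |L| , |R| , w≡ = begin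
  Pred 132 n w
    ≡⟨ Pred132-centre n w (reverse L) c R (trans (length-reverse L) |L|) |R|
         (trans w≡ (cong (_++ c ∷ R) (sym (reverse-involutive L)))) ⟩
  c ∧ (leadingOnes (reverse L) ≡ᵇ leadingOnes R)
    ≡⟨ cong (λ m → c ∧ (m ≡ᵇ leadingOnes R)) (sym (trailingOnes≡leadingOnes-reverse L)) ⟩
  predictAt 0 (trailingOnes L) (c ∷ R)
    ≡⟨ cong (λ k → predictAt k (trailingOnes L) (c ∷ R)) (sym (trans (cong (n ∸_) |L|) (n∸n≡0 n))) ⟩
  predictAt (n ∸ length L) (trailingOnes L) (c ∷ R)
    ≡⟨ sym (predictAt-++ˡ n 0 L (c ∷ R) (≤-reflexive |L|)) ⟩
  predictAt n 0 (L ++ c ∷ R)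
    ≡⟨ cong (predictAt n 0) (sym w≡) ⟩
  predictAt n 0 (toList w) ∎
  where open ≡-Reasoning

swap : ∀ {X Y Z} → Protocol X Y Z → Protocol Y X Z
swap (leaf z)      = leaf z
swap (alice f l r) = bob f (swap l) (swap r)
swap (bob f l r)   = alice f (swap l) (swap r)

run-swap : ∀ {X Y Z} (P : Protocol X Y Z) x y → run (swap P) y x ≡ run P x y
run-swap (leaf z)      x y = refl
run-swap (alice f l r) x y rewrite run-swap l x y | run-swap r x y = refl
run-swap (bob f l r)   x y rewrite run-swap l x y | run-swap r x y = refl

depth-swap : ∀ {X Y Z} (P : Protocol X Y Z) → depth (swap P) ≡ depth P
depth-swap (leaf z)      = refl
depth-swap (alice f l r) = cong₂ (λ a b → suc (a ⊔ b)) (depth-swap l) (depth-swap r)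
depth-swap (bob f l r)   = cong₂ (λ a b → suc (a ⊔ b)) (depth-swap l) (depth-swap r)

+-2^-suc : ∀ v b → v + 2 ^ suc b ≡ v + 2 ^ b + 2 ^ b
+-2^-suc v b = trans (cong (λ m → v + (2 ^ b + m)) (+-identityʳ (2 ^ b))) (sym (+-assoc v (2 ^ b) (2 ^ b)))

module _ {X Y : Set} where

  D≤-mono : ∀ {Z} {g : X → Y → Z} {k k′} → D≤ g k → k ≤ k′ → D≤ g k′
  D≤-mono (P , d , ok) k≤k′ = P , ≤-trans d k≤k′ , ok

  D≤-flip : ∀ {Z} {g : X → Y → Z} {k} → D≤ (flip g) k → D≤ g k
  D≤-flip (P , d , ok) =
    swap P , ≤-trans (≤-reflexive (depth-swap P)) d , λ x y → trans (run-swap P y x) (ok y x)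

  -- Alice reveals s x by binary search within [v, v + 2 ^ b), then Bob announces h (s x) y.
  module _ (s : X → ℕ) (h : ℕ → Y → Bool) where

    search : ℕ → ℕ → Protocol X Y Bool
    search v zero    = bob (h v) (leaf false) (leaf true)
    search v (suc b) = alice (λ x → v + 2 ^ b ≤ᵇ s x) (search v b) (search (v + 2 ^ b) b)

    depth-search : ∀ v b → depth (search v b) ≡ suc b
    depth-search v zero    = refl
    depth-search v (suc b) rewrite depth-search v b | depth-search (v + 2 ^ b) b = cong suc (⊔-idem (suc b))

    run-search : ∀ v b x y → v ≤ s x → s x < v + 2 ^ b → run (search v b) x y ≡ h (s x) y
    run-search v zero x y v≤s s<v+1
      rewrite ≤-antisym (m<1+n⇒m≤n (≤-trans s<v+1 (≤-reflexive (+-comm v 1)))) v≤s with h v y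
    ... | false = refl
    ... | true  = refl
    run-search v (suc b) x y v≤s s<v+2^[1+b] with v + 2 ^ b ≤ᵇ s x | ≤ᵇ-reflects-≤ (v + 2 ^ b) (s x)
    ... | true  | ofʸ v+2^b≤s =
      run-search (v + 2 ^ b) b x y v+2^b≤s (≤-trans s<v+2^[1+b] (≤-reflexive (+-2^-suc v b)))
    ... | false | ofⁿ v+2^b≰s = run-search v b x y v≤s (≰⇒> v+2^b≰s)

  D≤-alice : ∀ {g : X → Y → Bool} (s : X → ℕ) (h : ℕ → Y → Bool) b →
    (∀ x → s x < 2 ^ b) → (∀ x y → g x y ≡ h (s x) y) → D≤ g (suc b)
  D≤-alice s h b s<2^b g≡ =
    search s h 0 b , ≤-reflexive (depth-search s h 0 b) ,
    λ x y → trans (run-search s h 0 b x y z≤n (s<2^b x)) (sym (g≡ x y))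

n<2^suc⌊log₂n⌋ : ∀ n → n < 2 ^ suc ⌊log₂ n ⌋
n<2^suc⌊log₂n⌋ n with 2 ^ suc ⌊log₂ n ⌋ ≤? n
... | yes 2^suc⌊log₂n⌋≤n = contradiction (begin-strict
  ⌊log₂ n ⌋                     <⟨ n<1+n ⌊log₂ n ⌋ ⟩
  suc ⌊log₂ n ⌋                 ≡⟨ sym (⌊log₂[2^n]⌋≡n (suc ⌊log₂ n ⌋)) ⟩
  ⌊log₂ 2 ^ suc ⌊log₂ n ⌋ ⌋     ≤⟨ ⌊log₂⌋-mono-≤ 2^suc⌊log₂n⌋≤n ⟩
  ⌊log₂ n ⌋                     ∎) (n≮n ⌊log₂ n ⌋)
  where open ≤-Reasoning
... | no 2^suc⌊log₂n⌋≰n = ≰⇒> 2^suc⌊log₂n⌋≰n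

D≤-alice-≤ : ∀ {X Y n} {g : X → Y → Bool} (s : X → ℕ) (h : ℕ → Y → Bool) →
  (∀ x → s x ≤ n) → (∀ x y → g x y ≡ h (s x) y) → D≤ g (2 + ⌊log₂ n ⌋)
D≤-alice-≤ {n = n} s h s≤n = D≤-alice s h (suc ⌊log₂ n ⌋) (λ x → ≤-<-trans (s≤n x) (n<2^suc⌊log₂n⌋ n))

D≤-bob-≤ : ∀ {X Y n} {g : X → Y → Bool} (s : Y → ℕ) (h : X → ℕ → Bool) →
  (∀ y → s y ≤ n) → (∀ x y → g x y ≡ h x (s y)) → D≤ g (2 + ⌊log₂ n ⌋)
D≤-bob-≤ s h s≤n g≡ = D≤-flip (D≤-alice-≤ s (flip h) s≤n (flip g≡))

toList-subst : ∀ {A : Set} {m m′} (e : m ≡ m′) (v : Vec A m) → toList (subst (Vec A) e v) ≡ toList v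
toList-subst refl v = refl

Pred132-++ : ∀ n {i j} (e : i + j ≡ odd n) (x : Vec Bool i) (y : Vec Bool j) →
  Pred 132 n (subst (Vec Bool) e (x Vec.++ y)) ≡ predictAt n 0 (toList x ++ toList y)
Pred132-++ n e x y = begin
  Pred 132 n (subst (Vec Bool) e (x Vec.++ y))             ≡⟨ Pred132≡predictAt n _ ⟩
  predictAt n 0 (toList (subst (Vec Bool) e (x Vec.++ y))) ≡⟨ cong (predictAt n 0) (toList-subst e (x Vec.++ y)) ⟩
  predictAt n 0 (toList (x Vec.++ y))                      ≡⟨ cong (predictAt n 0) (toList-++ x y) ⟩
  predictAt n 0 (toList x ++ toList y)                     ∎
  where open ≡-Reasoning

module _ {n i j} (e : i + j ≡ odd n) (x : Vec Bool i) (y : Vec Bool j) where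

  Pred132-left-cut : i ≤ n →
    Pred 132 n (subst (Vec Bool) e (x Vec.++ y)) ≡ predictAt (n ∸ i) (trailingOnes (toList x)) (toList y)
  Pred132-left-cut i≤n = begin
    Pred 132 n (subst (Vec Bool) e (x Vec.++ y))
      ≡⟨ Pred132-++ n e x y ⟩
    predictAt n 0 (toList x ++ toList y)
      ≡⟨ predictAt-++ˡ n 0 (toList x) (toList y) (≤-trans (≤-reflexive (length-toList x)) i≤n) ⟩
    predictAt (n ∸ length (toList x)) (trailingOnes (toList x)) (toList y)
      ≡⟨ cong (λ m → predictAt (n ∸ m) (trailingOnes (toList x)) (toList y)) (length-toList x) ⟩
    predictAt (n ∸ i) (trailingOnes (toList x)) (toList y) ∎
    where open ≡-Reasoning

  Pred132-right-cut : n < i →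
    Pred 132 n (subst (Vec Bool) e (x Vec.++ y)) ≡ predictAt n 0 (toList x ++ replicate (leadingOnes (toList y)) true)
  Pred132-right-cut n<i = trans (Pred132-++ n e x y)
    (predictAt-++ʳ n 0 (toList x) (≤-trans n<i (≤-reflexive (sym (length-toList x))))
      (sym (leadingOnes-replicate (leadingOnes (toList y)))))

Pred132-D≤ : ∀ n → Dfun≤ (Pred 132 n) (2 + ⌊log₂ n ⌋)
Pred132-D≤ n i j e with i ≤? n
... | yes i≤n = D≤-alice-≤ (trailingOnes ∘ toList) (λ v y → predictAt (n ∸ i) v (toList y))
  (λ x → ≤-trans (trailingOnes≤length (toList x)) (≤-trans (≤-reflexive (length-toList x)) i≤n))
  (λ x y → Pred132-left-cut e x y i≤n)
... | no i≰n = D≤-bob-≤ (leadingOnes ∘ toList) (λ x v → predictAt n 0 (toList x ++ replicate v true))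
  (λ y → ≤-trans (leadingOnes≤length (toList y)) (≤-trans (≤-reflexive (length-toList y)) j≤n))
  (λ x y → Pred132-right-cut e x y (≰⇒> i≰n))
  where
  j≤n : j ≤ n
  j≤n = +-cancelˡ-≤ (suc n) j n (≤-trans (+-monoˡ-≤ j (≰⇒> i≰n))
          (≤-reflexive (trans e (trans (odd≡n+suc[n] n) (+-suc n n)))))

2+m≤3*m : ∀ {m} → 1 ≤ m → 2 + m ≤ 3 * m
2+m≤3*m {m} 1≤m = ≤-trans (≤-reflexive (+-comm 2 m)) (+-monoʳ-≤ m (*-monoʳ-≤ 2 1≤m))

proposition18 : ∃₂ λ (c n₀ : ℕ) →
    (n : ℕ) → n₀ ≤ n → Dfun≤ (Pred 132 n) (c * ⌊log₂ n ⌋)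
proposition18 = 3 , 2 , λ n 2≤n i j e → D≤-mono (Pred132-D≤ n i j e) (2+m≤3*m (1≤⌊log₂n⌋ 2≤n))
  where
  1≤⌊log₂n⌋ : ∀ {n} → 2 ≤ n → 1 ≤ ⌊log₂ n ⌋
  1≤⌊log₂n⌋ 2≤n = ≤-trans (≤-reflexive (sym (⌊log₂[2^n]⌋≡n 1))) (⌊log₂⌋-mono-≤ 2≤n)
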